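{- For every integer $n\ge1$, $$\sum_{P\in\mathcal{M}_n}q^{\operatorname{blocks}(P)}=\sum_{t=1}^{\lfloor (n+1)/2\rfloor}\binom{n-1}{2(t-1)}q^t,$$ where $\mathcal{M}_n$ is the set of non-crossing merging-free partitions of $[n]$ and $\operatorname{blocks}(P)$ is the number of blocks of $P$.
   Context: A set partition $P=B_1/\cdots/B_k$ of $[n]$ in block representation has blocks ordered by increasing minima. $P$ is merging-free if $\max B_i>\min B_{i+1}$ for $1\le i\le k-1$. $P$ is non-crossing if there are no $a<x<b<y$ with $a,b$ in one block and $x,y$ in a different block. -}

module Defs where

open import Data.Nat using (ℕ; zero; suc; _+_; _*_; _∸_; _^_; _<_; _⊔_; _/_)
open import Data.Nat.Combinatorics using (_C_)
open import Data.List using (List; []; _∷_; concat; map; upTo; length)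
open import Data.Nat.ListAction using (sum)
open import Data.Unit using (⊤)
open import Data.Maybe using (Maybe; just; nothing)
open import Data.Product using (_×_)
open import Data.Empty using (⊥)
open import Relation.Nullary using (¬_)
open import Relation.Binary.PropositionalEquality using (_≡_; _≢_)
open import Data.List.Relation.Unary.All using (All)
open import Data.List.Relation.Unary.Linked using (Linked)
open import Data.List.Membership.Propositional using (_∈_)
open import Data.List.Relation.Binary.Permutation.Propositional using (_↭_)

Block : Set
Block = List ℕ

Partition : Set
Partition = List Block

[_] : ℕ → List ℕ
[ n ] = map suc (upTo n)

NonEmpty : Block → Set
NonEmpty []      = ⊥
NonEmpty (_ ∷ _) = ⊤

-- minimum of a (strictly increasing, nonempty) block = its first element
minB : Block → ℕ
minB []      = 0
minB (x ∷ _) = x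

maxB : Block → ℕ
maxB []      = 0
maxB (x ∷ xs) = x ⊔ maxB xs

-- Block representation of a set partition of [n]:
-- every block nonempty and listed in increasing order, blocks ordered by
-- increasing minima, and the blocks together contain each element of [n]
-- exactly once.
IsSetPartition : ℕ → Partition → Set
IsSetPartition n P =
  All NonEmpty P ×
  All (Linked _<_) P ×
  Linked (λ B C → minB B < minB C) P ×
  (concat P ↭ [ n ])

MergingFree : Partition → Set
MergingFree P = Linked (λ B C → minB C < maxB B) P

NonCrossing : Partition → Set
NonCrossing P =
  ∀ {B C a b x y} → B ∈ P → C ∈ P → B ≢ C →
  a ∈ B → b ∈ B → x ∈ C → y ∈ C →
  ¬ (a < x × x < b × b < y)

NCMF : ℕ → Partition → Set
NCMF n P = IsSetPartition n P × MergingFree P × NonCrossing P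

blocks : Partition → ℕ
blocks = length

rhs : ℕ → ℕ → ℕ
rhs n q = sum (map (λ t → ((n ∸ 1) C (2 * (t ∸ 1))) * q ^ t) (map suc (upTo ((n + 1) / 2))))

-- The first block of an NCMF partition of an interval is an initial run and a final run of the
-- interval, and the remaining blocks form an NCMF partition of the gap between the two runs: the
-- maxima of consecutive blocks are nested (otherwise merging-freeness would make the blocks cross),
-- so all later blocks lie strictly inside the span of the first one, and an element of the first
-- block inside the gap would cross the second block. Unfolding this, an NCMF partition of [n] with
-- t blocks amounts to a composition of n into 2t - 1 positive run lengths, of which there are
-- C(n - 1, 2t - 2). The count follows the recurrences obtained by shortening the first or the final
-- run, which are Pascal's rule for the even and odd binomial sums.

module Submission where

open import Defs
open import Data.Nat using (ℕ; zero; suc; _+_; _*_; _∸_; _^_; _%_; _≤_; _<_; _/_; z≤n; s≤s; z<s; _<?_)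
open import Data.Nat.Properties
open import Data.Nat.Combinatorics using (_C_; k>n⇒nCk≡0; nCk+nC[k+1]≡[n+1]C[k+1])
open import Data.Nat.DivMod using (m≡m%n+[m/n]*n; m%n<n)
open import Data.Nat.ListAction using (sum)
open import Data.Nat.ListAction.Properties using (sum-++; sum-↭)
open import Data.List using (List; []; _∷_; _++_; map; concat; length; applyUpTo)
open import Data.List.Properties
  using ( map-++; map-∘; map-cong; map-applyUpTo; applyUpTo-∷ʳ; ++-assoc; ++-identityʳ; length-++
        ; ∷-injectiveˡ; ∷-injectiveʳ)
open import Data.List.Relation.Unary.Linked as Linked using (Linked; []; [-]; _∷_)
open import Data.List.Relation.Unary.Linked.Properties using (Linked⇒AllPairs)
open import Data.List.Relation.Unary.Any using (here; there)
open import Data.List.Relation.Unary.All as All using (All; []; _∷_)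
open import Data.List.Relation.Unary.AllPairs as AllPairs using ([]; _∷_)
open import Data.List.Relation.Unary.Unique.Propositional using (Unique)
import Data.List.Relation.Unary.Unique.Propositional.Properties as Unique
open import Data.List.Membership.Propositional using (_∈_)
open import Data.List.Membership.Propositional.Properties
  using (∈-++⁺ˡ; ∈-++⁺ʳ; ∈-++⁻; ∈-concat⁺′; ∈-map⁺; ∈-map⁻)
open import Data.List.Membership.Propositional.Properties.WithK using (unique∧set⇒bag)
open import Data.List.Relation.Binary.BagAndSetEquality using (∼bag⇒↭)
open import Data.List.Relation.Binary.Permutation.Propositional
  using (_↭_; ↭-sym; ↭-reflexive; ↭⇒↭ₛ; module PermutationReasoning)
open import Data.List.Relation.Binary.Permutation.Setoid.Properties using (Unique-resp-↭)
open import Data.List.Relation.Binary.Permutation.Propositional.Properties using (∈-resp-↭; ++⁺ˡ; ++-comm)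
import Data.List.Relation.Binary.Permutation.Propositional.Properties as Perm
open import Data.Product using (∃; _×_; _,_; proj₁; proj₂)
import Data.Product as Product
open import Data.Sum using (_⊎_; inj₁; inj₂)
open import Data.Empty using (⊥; ⊥-elim)
open import Function.Base using (_∘_)
open import Function.Bundles using (_⇔_; mk⇔; Equivalence)
open import Function.Properties.Equivalence using () renaming (trans to ⇔-trans; sym to ⇔-sym)
open import Relation.Nullary using (¬_; yes; no)
open import Relation.Binary.Definitions using (tri<; tri≈; tri>)
open import Relation.Binary.PropositionalEquality
  using (_≡_; _≢_; refl; sym; trans; cong; cong₂; subst; setoid; module ≡-Reasoning)

private
  variable
    A : Set
    x z : ℕ
    xs ys : List ℕ

Increasing : List ℕ → Set
Increasing = Linked _<_

head<tail : Increasing (x ∷ xs) → z ∈ xs → x < z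
head<tail inc = All.lookup (AllPairs.head (Linked⇒AllPairs <-trans inc))

head≤ : Increasing (x ∷ xs) → z ∈ x ∷ xs → x ≤ z
head≤ inc (here refl) = ≤-refl
head≤ inc (there z∈)  = <⇒≤ (head<tail inc z∈)

increasing⇒unique : Increasing xs → Unique xs
increasing⇒unique inc = AllPairs.map <⇒≢ (Linked⇒AllPairs <-trans inc)

increasing-ext : Increasing xs → Increasing ys → (∀ {z} → z ∈ xs ⇔ z ∈ ys) → xs ≡ ys
increasing-ext {[]}     {[]}     _ _ _ = refl
increasing-ext {[]}     {y ∷ ys} _ _ xs≈ys with Equivalence.from xs≈ys (here refl)
... | ()
increasing-ext {x ∷ xs} {[]}     _ _ xs≈ys with Equivalence.to xs≈ys (here refl)
... | ()
increasing-ext {x ∷ xs} {y ∷ ys} incx incy xs≈ys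
  with ≤-antisym (head≤ incx (Equivalence.from xs≈ys (here refl)))
                 (head≤ incy (Equivalence.to xs≈ys (here refl)))
... | refl = cong (x ∷_) (increasing-ext (Linked.tail incx) (Linked.tail incy)
                           (mk⇔ (drop incx (Equivalence.to xs≈ys)) (drop incy (Equivalence.from xs≈ys))))
  where
  drop : ∀ {us vs} → Increasing (x ∷ us) → (∀ {z} → z ∈ x ∷ us → z ∈ x ∷ vs) → ∀ {z} → z ∈ us → z ∈ vs
  drop inc f z∈ with f (there z∈)
  ... | here refl = ⊥-elim (<-irrefl refl (head<tail inc z∈))
  ... | there z∈′ = z∈′

unique∧set⇒↭ : {us vs : List A} → Unique us → Unique vs → (∀ {z} → z ∈ us ⇔ z ∈ vs) → us ↭ vs
unique∧set⇒↭ u v us≈vs = ∼bag⇒↭ (unique∧set⇒bag u v us≈vs)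

unique-↭ : {us vs : List A} → us ↭ vs → Unique us → Unique vs
unique-↭ {A = A} us↭vs = Unique-resp-↭ (setoid A) (↭⇒↭ₛ us↭vs)

unique-++⇒disjoint : ∀ {a} (us : List A) {vs} → Unique (us ++ vs) → a ∈ us → a ∈ vs → ⊥
unique-++⇒disjoint (u ∷ us) (u∉ ∷ _) (here refl) a∈vs = All.lookup u∉ (∈-++⁺ʳ us a∈vs) refl
unique-++⇒disjoint (u ∷ us) (_ ∷ !)  (there a∈) a∈vs  = unique-++⇒disjoint us ! a∈ a∈vs

unique-++⇒uniqueʳ : ∀ (us : List A) {vs} → Unique (us ++ vs) → Unique vs
unique-++⇒uniqueʳ []       !       = !
unique-++⇒uniqueʳ (u ∷ us) (_ ∷ !) = unique-++⇒uniqueʳ us !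

sum-map-++ : ∀ (f : A → ℕ) us vs → sum (map f (us ++ vs)) ≡ sum (map f us) + sum (map f vs)
sum-map-++ f us vs = trans (cong sum (map-++ f us vs)) (sum-++ (map f us) (map f vs))

sum-map-∘ : ∀ {B : Set} (f : B → ℕ) (g : A → B) us → sum (map f (map g us)) ≡ sum (map (f ∘ g) us)
sum-map-∘ f g us = cong sum (sym (map-∘ us))

sum-*ˡ : ∀ q ns → sum (map (q *_) ns) ≡ q * sum ns
sum-*ˡ q []       = sym (*-zeroʳ q)
sum-*ˡ q (n ∷ ns) = trans (cong (q * n +_) (sum-*ˡ q ns)) (sym (*-distribˡ-+ q n (sum ns)))

interval : ℕ → ℕ → List ℕ
interval s zero    = []
interval s (suc n) = s ∷ interval (suc s) n

∈-interval⁻ : ∀ s n → z ∈ interval s n → s ≤ z × z < s + n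
∈-interval⁻ s (suc n) (here refl) = ≤-refl , m<m+n s z<s
∈-interval⁻ {z} s (suc n) (there z∈) with ∈-interval⁻ (suc s) n z∈
... | s<z , z<end = <⇒≤ s<z , subst (z <_) (sym (+-suc s n)) z<end

∈-interval⁺ : ∀ s n → s ≤ z → z < s + n → z ∈ interval s n
∈-interval⁺ s zero s≤z z<s+0 = ⊥-elim (<⇒≱ z<s+0 (≤-trans (≤-reflexive (+-identityʳ s)) s≤z))
∈-interval⁺ {z} s (suc n) s≤z z<end with m≤n⇒m<n∨m≡n s≤z
... | inj₂ refl = here refl
... | inj₁ s<z  = there (∈-interval⁺ (suc s) n s<z (subst (z <_) (+-suc s n) z<end))

∈-interval⇔ : ∀ {z t} s n → s + n ≡ t → z ∈ interval s n ⇔ (s ≤ z × z < t)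
∈-interval⇔ s n refl = mk⇔ (∈-interval⁻ s n) (λ (s≤z , z<t) → ∈-interval⁺ s n s≤z z<t)

interval-increasing : ∀ s n → Increasing (interval s n)
interval-increasing s zero          = []
interval-increasing s (suc zero)    = [-]
interval-increasing s (suc (suc n)) = ≤-refl ∷ interval-increasing (suc s) (suc n)

interval-unique : ∀ s n → Unique (interval s n)
interval-unique s n = increasing⇒unique (interval-increasing s n)

interval-++-increasing : ∀ s n → Increasing ys → All (s + n ≤_) ys → Increasing (interval s n ++ ys)
interval-++-increasing s zero          inc _            = inc
interval-++-increasing s (suc zero)    []  _            = [-]
interval-++-increasing s (suc zero)    inc (s+1≤y ∷ _)  = ≤-trans (≤-reflexive (+-comm 1 s)) s+1≤y ∷ inc
interval-++-increasing s (suc (suc n)) inc above        =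
  ≤-refl ∷ interval-++-increasing (suc s) (suc n) inc
             (All.map (≤-trans (≤-reflexive (sym (+-suc s (suc n))))) above)

twoRuns-increasing : ∀ s m t n → s + m ≤ t → Increasing (interval s m ++ interval t n)
twoRuns-increasing s m t n gap =
  interval-++-increasing s m (interval-increasing t n)
    (All.tabulate (λ y∈ → ≤-trans gap (proj₁ (∈-interval⁻ t n y∈))))

interval-++ : ∀ s m n → interval s (m + n) ≡ interval s m ++ interval (s + m) n
interval-++ s zero    n = cong (λ t → interval t n) (sym (+-identityʳ s))
interval-++ s (suc m) n = cong (s ∷_) (begin
  interval (suc s) (m + n)
    ≡⟨ interval-++ (suc s) m n ⟩
  interval (suc s) m ++ interval (suc s + m) n
    ≡⟨ cong (λ t → interval (suc s) m ++ interval t n) (sym (+-suc s m)) ⟩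
  interval (suc s) m ++ interval (s + suc m) n ∎)
  where open ≡-Reasoning

length-interval : ∀ s n → length (interval s n) ≡ n
length-interval s zero    = refl
length-interval s (suc n) = cong suc (length-interval (suc s) n)

applyUpTo-interval : ∀ (f : ℕ → ℕ) s n → (∀ i → f i ≡ s + i) → applyUpTo f n ≡ interval s n
applyUpTo-interval f s zero    f≗s+ = refl
applyUpTo-interval f s (suc n) f≗s+ =
  cong₂ _∷_ (trans (f≗s+ 0) (+-identityʳ s))
            (applyUpTo-interval (f ∘ suc) (suc s) n (λ i → trans (f≗s+ (suc i)) (+-suc s i)))

[n]≡interval : ∀ n → [ n ] ≡ interval 1 n
[n]≡interval n = trans (map-applyUpTo (λ i → i) suc n) (applyUpTo-interval suc 1 n (λ i → refl))

-- Non-crossing merging-free partitions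

≤maxB : ∀ B → z ∈ B → z ≤ maxB B
≤maxB (x ∷ xs) (here refl) = m≤m⊔n x (maxB xs)
≤maxB (x ∷ xs) (there z∈)  = ≤-trans (≤maxB xs z∈) (m≤n⊔m x (maxB xs))

maxB∈ : ∀ x xs → maxB (x ∷ xs) ∈ x ∷ xs
maxB∈ x []       = here (⊔-identityʳ x)
maxB∈ x (y ∷ ys) with ⊔-sel x (maxB (y ∷ ys))
... | inj₁ max≡x = here max≡x
... | inj₂ max≡m = there (subst (_∈ y ∷ ys) (sym max≡m) (maxB∈ y ys))

IsPartitionOf : List ℕ → Partition → Set
IsPartitionOf X P =
  All NonEmpty P × All Increasing P × Linked (λ B C → minB B < minB C) P × (concat P ↭ X)

NCMFOf : List ℕ → Partition → Set
NCMFOf X P = IsPartitionOf X P × MergingFree P × NonCrossing P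

record IsNCMF (P : Partition) : Set where
  field
    nonEmpty    : All NonEmpty P
    increasing  : All Increasing P
    minima      : Linked (λ B C → minB B < minB C) P
    mergingFree : MergingFree P
    nonCrossing : NonCrossing P
    disjoint    : Unique (concat P)

ncmfOf⇒isNCMF : ∀ {X P} → NCMFOf X P → Unique X → IsNCMF P
ncmfOf⇒isNCMF ((ne , inc , mins , cover) , mf , nc) X! =
  record { nonEmpty = ne ; increasing = inc ; minima = mins ; mergingFree = mf ; nonCrossing = nc
         ; disjoint = unique-↭ (↭-sym cover) X! }

isNCMF-tail : ∀ {B Q} → IsNCMF (B ∷ Q) → IsNCMF Q
isNCMF-tail {B} ncmf = record
  { nonEmpty    = All.tail nonEmpty
  ; increasing  = All.tail increasing
  ; minima      = Linked.tail minima
  ; mergingFree = Linked.tail mergingFree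
  ; nonCrossing = λ B∈ C∈ → nonCrossing (there B∈) (there C∈)
  ; disjoint    = unique-++⇒uniqueʳ B disjoint
  }
  where open IsNCMF ncmf

ncmfOf-tail : ∀ {X Y B Q} → NCMFOf X (B ∷ Q) → concat Q ↭ Y → NCMFOf Y Q
ncmfOf-tail ((ne , inc , mins , _) , mf , nc) cover =
  (All.tail ne , All.tail inc , Linked.tail mins , cover) , Linked.tail mf ,
  λ B∈ C∈ → nc (there B∈) (there C∈)

-- Otherwise the two maxima would be interleaved with the two minima as in a crossing.
maxB-nested : ∀ {B C R} → IsNCMF (B ∷ C ∷ R) → maxB C < maxB B
maxB-nested {b ∷ bs} {c ∷ cs} ncmf with <-cmp (maxB (c ∷ cs)) (maxB (b ∷ bs))
... | tri< maxC<maxB _ _ = maxC<maxB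
... | tri≈ _ maxC≡maxB _ =
  ⊥-elim (unique-++⇒disjoint (b ∷ bs) disjoint (maxB∈ b bs)
           (∈-++⁺ˡ (subst (_∈ c ∷ cs) maxC≡maxB (maxB∈ c cs))))
  where open IsNCMF ncmf
... | tri> _ _ maxB<maxC =
  ⊥-elim (nonCrossing (here refl) (there (here refl)) (λ { refl → <-irrefl refl b<c })
           (here refl) (maxB∈ b bs) (here refl) (maxB∈ c cs) (b<c , Linked.head mergingFree , maxB<maxC))
  where
  open IsNCMF ncmf
  b<c = Linked.head minima
maxB-nested {[]} ncmf with IsNCMF.nonEmpty ncmf
... | () ∷ _
maxB-nested {_ ∷ _} {[]} ncmf with IsNCMF.nonEmpty ncmf
... | _ ∷ () ∷ _

spans : ∀ B Q → IsNCMF (B ∷ Q) → z ∈ concat (B ∷ Q) → minB B ≤ z × z ≤ maxB B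
inside : ∀ B Q → IsNCMF (B ∷ Q) → z ∈ concat Q → minB B < z × z < maxB B

spans []       Q ncmf z∈ with IsNCMF.nonEmpty ncmf
... | () ∷ _
spans (b ∷ bs) Q ncmf z∈ with ∈-++⁻ (b ∷ bs) z∈
... | inj₁ z∈B = head≤ (All.head (IsNCMF.increasing ncmf)) z∈B , ≤maxB (b ∷ bs) z∈B
... | inj₂ z∈Q = Product.map <⇒≤ <⇒≤ (inside (b ∷ bs) Q ncmf z∈Q)

inside B []        ncmf ()
inside B (B′ ∷ R) ncmf z∈ =
  <-≤-trans (Linked.head (IsNCMF.minima ncmf)) (proj₁ bounds) , ≤-<-trans (proj₂ bounds) (maxB-nested ncmf)
  where bounds = spans B′ R (isNCMF-tail ncmf) z∈

-- single c is the block {s, …, s + c}; wrap c σ d has as first block an initial run of c + 1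
-- and a final run of d + 1 elements, with the partition σ filling the gap between them.
data Shape : Set where
  single : ℕ → Shape
  wrap   : ℕ → Shape → ℕ → Shape

size : Shape → ℕ
size (single c)   = suc c
size (wrap c σ d) = suc c + (size σ + suc d)

depth : Shape → ℕ
depth (single _)   = 1
depth (wrap _ σ _) = suc (depth σ)

outerBlock : ℕ → ℕ → Shape → ℕ → Block
outerBlock s c σ d = interval s (suc c) ++ interval (s + suc c + size σ) (suc d)

partition : ℕ → Shape → Partition
partition s (single c)   = interval s (suc c) ∷ []
partition s (wrap c σ d) = outerBlock s c σ d ∷ partition (s + suc c) σ

0<size : ∀ σ → 0 < size σ
0<size (single _)   = z<s
0<size (wrap _ _ _) = z<s

blocks-partition : ∀ s σ → blocks (partition s σ) ≡ depth σ
blocks-partition s (single c)   = refl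
blocks-partition s (wrap c σ d) = cong suc (blocks-partition (s + suc c) σ)

concat-partition : ∀ s σ → concat (partition s σ) ↭ interval s (size σ)
concat-partition s (single c)   = ↭-reflexive (++-identityʳ (interval s (suc c)))
concat-partition s (wrap c σ d) = begin
  concat (partition s (wrap c σ d)) ≡⟨ ++-assoc initial final (concat (partition s′ σ)) ⟩
  initial ++ final ++ concat (partition s′ σ)  ↭⟨ ++⁺ˡ initial (++⁺ˡ final (concat-partition s′ σ)) ⟩
  initial ++ final ++ interval s′ (size σ)     ↭⟨ ++⁺ˡ initial (++-comm final (interval s′ (size σ))) ⟩
  initial ++ interval s′ (size σ) ++ final     ≡⟨ sym (cong (initial ++_) (interval-++ s′ (size σ) (suc d))) ⟩
  initial ++ interval s′ (size σ + suc d)      ≡⟨ sym (interval-++ s (suc c) (size σ + suc d)) ⟩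
  interval s (size (wrap c σ d))               ∎
  where
  open PermutationReasoning
  s′ = s + suc c
  initial = interval s (suc c)
  final = interval (s′ + size σ) (suc d)

∈-partition⁻ : ∀ s σ {C} → C ∈ partition s σ → z ∈ C → s ≤ z × z < s + size σ
∈-partition⁻ s σ C∈ z∈ = ∈-interval⁻ s (size σ) (∈-resp-↭ (concat-partition s σ) (∈-concat⁺′ z∈ C∈))

outerBlock-gap : ∀ s c σ d → z ∈ outerBlock s c σ d → s + suc c ≤ z → z < s + suc c + size σ → ⊥
outerBlock-gap s c σ d z∈ gap≤z z<gap with ∈-++⁻ (interval s (suc c)) z∈
... | inj₁ z∈initial = <⇒≱ (proj₂ (∈-interval⁻ s (suc c) z∈initial)) gap≤z
... | inj₂ z∈final   = <⇒≱ z<gap (proj₁ (∈-interval⁻ (s + suc c + size σ) (suc d) z∈final))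

partition-nonEmpty : ∀ s σ → All NonEmpty (partition s σ)
partition-nonEmpty s (single c)   = _ ∷ []
partition-nonEmpty s (wrap c σ d) = _ ∷ partition-nonEmpty (s + suc c) σ

partition-increasing : ∀ s σ → All Increasing (partition s σ)
partition-increasing s (single c)   = interval-increasing s (suc c) ∷ []
partition-increasing s (wrap c σ d) =
  twoRuns-increasing s (suc c) _ (suc d) (m≤m+n _ (size σ)) ∷ partition-increasing (s + suc c) σ

partition-minima : ∀ s σ → Linked (λ B C → minB B < minB C) (partition s σ)
partition-minima s (single c)                = [-]
partition-minima s (wrap c σ@(single _) d)   = m<m+n s z<s ∷ partition-minima (s + suc c) σ
partition-minima s (wrap c σ@(wrap _ _ _) d) = m<m+n s z<s ∷ partition-minima (s + suc c) σ

inner<maxB-outerBlock : ∀ s c σ d → s + suc c < maxB (outerBlock s c σ d)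
inner<maxB-outerBlock s c σ d =
  <-≤-trans (m<m+n (s + suc c) (0<size σ))
            (≤maxB (outerBlock s c σ d) (∈-++⁺ʳ (interval s (suc c)) (here refl)))

partition-mergingFree : ∀ s σ → MergingFree (partition s σ)
partition-mergingFree s (single c)                = [-]
partition-mergingFree s (wrap c σ@(single _) d)   =
  inner<maxB-outerBlock s c σ d ∷ partition-mergingFree (s + suc c) σ
partition-mergingFree s (wrap c σ@(wrap _ _ _) d) =
  inner<maxB-outerBlock s c σ d ∷ partition-mergingFree (s + suc c) σ

partition-nonCrossing : ∀ s σ → NonCrossing (partition s σ)
partition-nonCrossing s (single c)   (here refl) (here refl) B≢C = ⊥-elim (B≢C refl)
partition-nonCrossing s (wrap c σ d) (here refl) (here refl) B≢C = ⊥-elim (B≢C refl)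
partition-nonCrossing s (wrap c σ d) (there B∈) (there C∈) = partition-nonCrossing (s + suc c) σ B∈ C∈
partition-nonCrossing s (wrap c σ d) (here refl) (there C∈) _ _ b∈ x∈ y∈ (_ , x<b , b<y) =
  outerBlock-gap s c σ d b∈ (≤-trans (proj₁ (∈-partition⁻ _ σ C∈ x∈)) (<⇒≤ x<b))
                            (<-trans b<y (proj₂ (∈-partition⁻ _ σ C∈ y∈)))
partition-nonCrossing s (wrap c σ d) (there B∈) (here refl) _ a∈ b∈ x∈ _ (a<x , x<b , _) =
  outerBlock-gap s c σ d x∈ (≤-trans (proj₁ (∈-partition⁻ _ σ B∈ a∈)) (<⇒≤ a<x))
                            (<-trans x<b (proj₂ (∈-partition⁻ _ σ B∈ b∈)))

partition-ncmf : ∀ s σ → NCMFOf (interval s (size σ)) (partition s σ)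
partition-ncmf s σ =
  (partition-nonEmpty s σ , partition-increasing s σ , partition-minima s σ , concat-partition s σ) ,
  partition-mergingFree s σ , partition-nonCrossing s σ

partition≢[] : ∀ s σ → partition s σ ≢ []
partition≢[] s (single _)   ()
partition≢[] s (wrap _ _ _) ()

minB-concat-partition : ∀ s σ → minB (concat (partition s σ)) ≡ s
minB-concat-partition s (single _)   = refl
minB-concat-partition s (wrap _ _ _) = refl

length-outerBlock : ∀ s c σ d → length (outerBlock s c σ d) ≡ suc c + suc d
length-outerBlock s c σ d =
  trans (length-++ (interval s (suc c))) (cong₂ _+_ (length-interval s (suc c)) (length-interval _ (suc d)))

partition-injective : ∀ s {σ τ} → partition s σ ≡ partition s τ → σ ≡ τ
partition-injective s {single c} {single c′} eq =
  cong single (suc-injective (begin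
    suc c                                ≡⟨ sym (length-interval s (suc c)) ⟩
    length (interval s (suc c))          ≡⟨ cong length (∷-injectiveˡ eq) ⟩
    length (interval s (suc c′))         ≡⟨ length-interval s (suc c′) ⟩
    suc c′                               ∎))
  where open ≡-Reasoning
partition-injective s {single _}   {wrap _ τ _} eq = ⊥-elim (partition≢[] _ τ (sym (∷-injectiveʳ eq)))
partition-injective s {wrap _ σ _} {single _}   eq = ⊥-elim (partition≢[] _ σ (∷-injectiveʳ eq))
partition-injective s {wrap c σ d} {wrap c′ τ d′} eq
  with +-cancelˡ-≡ s _ _ (trans (sym (minB-concat-partition _ σ))
                                (trans (cong (minB ∘ concat) (∷-injectiveʳ eq)) (minB-concat-partition _ τ)))
... | refl with partition-injective (s + suc c) (∷-injectiveʳ eq)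
... | refl = cong (wrap c σ) (suc-injective (+-cancelˡ-≡ (suc c) _ _ (begin
    suc c + suc d                    ≡⟨ sym (length-outerBlock s c σ d) ⟩
    length (outerBlock s c σ d)      ≡⟨ cong length (∷-injectiveˡ eq) ⟩
    length (outerBlock s c σ d′)     ≡⟨ length-outerBlock s c σ d′ ⟩
    suc c + suc d′                   ∎)))
  where open ≡-Reasoning

-- Decomposing NCMF partitions

HasShape : ℕ → ℕ → Partition → Set
HasShape s k P = ∃ λ σ → size σ ≡ suc k × P ≡ partition s σ

record Wrapping (s k : ℕ) (B : Block) (c : ℕ) (Q : Partition) : Set where
  field
    initial inner final : ℕ
    start       : s + suc initial ≡ c
    inner-cover : concat Q ↭ interval c (suc inner)
    outer       : B ≡ interval s (suc initial) ++ interval (c + suc inner) (suc final)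
    total       : suc initial + (suc inner + suc final) ≡ suc k

module _ {s k b c : ℕ} {bs cs : List ℕ} {R : Partition}
         (ncmf : NCMFOf (interval s (suc k)) ((b ∷ bs) ∷ (c ∷ cs) ∷ R)) where

  private
    B = b ∷ bs
    Q = (c ∷ cs) ∷ R
    e = maxB (c ∷ cs)
    isNCMF = ncmfOf⇒isNCMF ncmf (interval-unique s (suc k))
    cover = proj₂ (proj₂ (proj₂ (proj₁ ncmf)))

    ∈-cover⁻ : z ∈ concat (B ∷ Q) → s ≤ z × z < s + suc k
    ∈-cover⁻ z∈ = ∈-interval⁻ s (suc k) (∈-resp-↭ cover z∈)

    ∈-cover⁺ : s ≤ z → z < s + suc k → z ∈ B ⊎ z ∈ concat Q
    ∈-cover⁺ s≤z z<end = ∈-++⁻ B (∈-resp-↭ (↭-sym cover) (∈-interval⁺ s (suc k) s≤z z<end))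

    B∩Q=∅ : z ∈ B → z ∈ concat Q → ⊥
    B∩Q=∅ = unique-++⇒disjoint B (IsNCMF.disjoint isNCMF)

  first-block-min : b ≡ s
  first-block-min =
    ≤-antisym (proj₁ (spans B Q isNCMF (∈-resp-↭ (↭-sym cover) (here refl))))
              (proj₁ (∈-cover⁻ (here refl)))

  b<c : b < c
  b<c = Linked.head (IsNCMF.minima isNCMF)

  s<c : s < c
  s<c = subst (_< c) first-block-min b<c

  c≤e : c ≤ e
  c≤e = ≤maxB (c ∷ cs) (here refl)

  e<end : suc e < s + suc k
  e<end = ≤-<-trans (maxB-nested isNCMF) (proj₂ (∈-cover⁻ (∈-++⁺ˡ (maxB∈ b bs))))

  ∈-inner⁻ : z ∈ concat Q → c ≤ z × z ≤ e
  ∈-inner⁻ = spans (c ∷ cs) R (isNCMF-tail isNCMF)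

  -- An element of the first block strictly between c and e would cross the second block.
  ∈-inner⁺ : c ≤ z → z ≤ e → z ∈ concat Q
  ∈-inner⁺ {z} c≤z z≤e with ∈-cover⁺ (≤-trans (<⇒≤ s<c) c≤z)
                                   (<-trans (s≤s z≤e) e<end)
  ... | inj₂ z∈Q = z∈Q
  ... | inj₁ z∈B = ⊥-elim (IsNCMF.nonCrossing isNCMF (here refl) (there (here refl))
                       (λ { refl → <-irrefl refl b<c }) (here refl) z∈B (here refl) (maxB∈ c cs)
                       (b<c , ≤∧≢⇒< c≤z (λ { refl → B∩Q=∅ z∈B (here refl) })
                            , ≤∧≢⇒< z≤e (λ { refl → B∩Q=∅ z∈B (∈-++⁺ˡ (maxB∈ c cs)) })))

  ∈-outer⁻ : z ∈ B → (s ≤ z × z < c) ⊎ (e < z × z < s + suc k)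
  ∈-outer⁻ {z} z∈B with ∈-cover⁻ (∈-++⁺ˡ z∈B) | z <? c | e <? z
  ... | s≤z , _     | yes z<c | _       = inj₁ (s≤z , z<c)
  ... | _ , z<end   | no _    | yes e<z = inj₂ (e<z , z<end)
  ... | _           | no z≮c  | no e≮z  = ⊥-elim (B∩Q=∅ z∈B (∈-inner⁺ (≮⇒≥ z≮c) (≮⇒≥ e≮z)))

  ∈-outer⁺ : (s ≤ z × z < c) ⊎ (e < z × z < s + suc k) → z ∈ B
  ∈-outer⁺ {z} (inj₁ (s≤z , z<c)) with ∈-cover⁺ s≤z (<-trans z<c (≤-<-trans c≤e (<-trans (n<1+n e) e<end)))
  ... | inj₁ z∈B = z∈B
  ... | inj₂ z∈Q = ⊥-elim (<⇒≱ z<c (proj₁ (∈-inner⁻ z∈Q)))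
  ∈-outer⁺ {z} (inj₂ (e<z , z<end)) with ∈-cover⁺ (≤-trans (<⇒≤ s<c) (≤-trans c≤e (<⇒≤ e<z))) z<end
  ... | inj₁ z∈B = z∈B
  ... | inj₂ z∈Q = ⊥-elim (<⇒≱ e<z (proj₂ (∈-inner⁻ z∈Q)))

  concat-inner↭interval : ∀ j → c + suc j ≡ suc e → concat Q ↭ interval c (suc j)
  concat-inner↭interval j gap-end =
    unique∧set⇒↭ (unique-++⇒uniqueʳ B (IsNCMF.disjoint isNCMF)) (interval-unique c (suc j)) (mk⇔ to from)
    where
    gap : z ∈ interval c (suc j) ⇔ (c ≤ z × z < suc e)
    gap = ∈-interval⇔ c (suc j) gap-end
    to : z ∈ concat Q → z ∈ interval c (suc j)
    to z∈ = let c≤z , z≤e = ∈-inner⁻ z∈ in Equivalence.from gap (c≤z , s≤s z≤e)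
    from : z ∈ interval c (suc j) → z ∈ concat Q
    from z∈ = let c≤z , z<1+e = Equivalence.to gap z∈ in ∈-inner⁺ c≤z (≤-pred z<1+e)

  outer-runs : ∀ c′ d → s + suc c′ ≡ c → suc e + suc d ≡ s + suc k →
               B ≡ interval s (suc c′) ++ interval (suc e) (suc d)
  outer-runs c′ d start end =
    increasing-ext (All.head (IsNCMF.increasing isNCMF))
      (twoRuns-increasing s (suc c′) (suc e) (suc d) (≤-trans (≤-reflexive start) (≤-trans c≤e (n≤1+n e))))
      (mk⇔ to from)
    where
    initial-run : z ∈ interval s (suc c′) ⇔ (s ≤ z × z < c)
    initial-run = ∈-interval⇔ s (suc c′) start
    final-run : z ∈ interval (suc e) (suc d) ⇔ (e < z × z < s + suc k)
    final-run = ∈-interval⇔ (suc e) (suc d) end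
    to : z ∈ B → z ∈ interval s (suc c′) ++ interval (suc e) (suc d)
    to z∈ with ∈-outer⁻ z∈
    ... | inj₁ in-initial = ∈-++⁺ˡ (Equivalence.from initial-run in-initial)
    ... | inj₂ in-final   = ∈-++⁺ʳ (interval s (suc c′)) (Equivalence.from final-run in-final)
    from : z ∈ interval s (suc c′) ++ interval (suc e) (suc d) → z ∈ B
    from z∈ with ∈-++⁻ (interval s (suc c′)) z∈
    ... | inj₁ z∈initial = ∈-outer⁺ (inj₁ (Equivalence.to initial-run z∈initial))
    ... | inj₂ z∈final   = ∈-outer⁺ (inj₂ (Equivalence.to final-run z∈final))

  wrapping : Wrapping s k B c Q
  wrapping with m≤n⇒∃[o]m+o≡n s<c | m≤n⇒∃[o]m+o≡n c≤e | m≤n⇒∃[o]m+o≡n e<end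
  ... | c′ , 1+s+c′≡c | j , c+j≡e | d , 2+e+d≡end = record
    { initial     = c′
    ; inner       = j
    ; final       = d
    ; start       = start
    ; inner-cover = concat-inner↭interval j gap-end
    ; outer       = subst (λ t → B ≡ interval s (suc c′) ++ interval t (suc d)) (sym gap-end)
                          (outer-runs c′ d start end)
    ; total       = total
    }
    where
    start : s + suc c′ ≡ c
    start = trans (+-suc s c′) 1+s+c′≡c
    gap-end : c + suc j ≡ suc e
    gap-end = trans (+-suc c j) (cong suc c+j≡e)
    end : suc e + suc d ≡ s + suc k
    end = trans (+-suc (suc e) d) 2+e+d≡end

    total : suc c′ + (suc j + suc d) ≡ suc k
    total = +-cancelˡ-≡ s _ _ (begin
      s + (suc c′ + (suc j + suc d)) ≡⟨ sym (+-assoc s (suc c′) _) ⟩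
      s + suc c′ + (suc j + suc d)   ≡⟨ cong (_+ (suc j + suc d)) start ⟩
      c + (suc j + suc d)            ≡⟨ sym (+-assoc c (suc j) (suc d)) ⟩
      c + suc j + suc d              ≡⟨ cong (_+ suc d) gap-end ⟩
      suc e + suc d                  ≡⟨ end ⟩
      s + suc k                      ∎)
      where open ≡-Reasoning

  wrapping-shape : (∀ j → NCMFOf (interval c (suc j)) Q → HasShape c j Q) → HasShape s k (B ∷ Q)
  wrapping-shape shape-of-inner =
    wrap initial σ final , size-eq , cong₂ _∷_ B≡ (trans Q≡ (cong (λ t → partition t σ) (sym start)))
    where
    open Wrapping wrapping
    inner-shape = shape-of-inner inner (ncmfOf-tail ncmf inner-cover)
    σ = proj₁ inner-shape
    size≡ = proj₁ (proj₂ inner-shape)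
    Q≡ = proj₂ (proj₂ inner-shape)

    size-eq : suc initial + (size σ + suc final) ≡ suc k
    size-eq = trans (cong (λ n → suc initial + (n + suc final)) size≡) total
    B≡ : B ≡ outerBlock s initial σ final
    B≡ = trans outer (cong₂ (λ t n → interval s (suc initial) ++ interval (t + n) (suc final))
                            (sym start) (sym size≡))

complete : ∀ s k P → NCMFOf (interval s (suc k)) P → HasShape s k P
complete s k [] ((_ , _ , _ , cover) , _) with ∈-resp-↭ (↭-sym cover) (here {x = s} refl)
... | ()
complete s k (B ∷ []) ((_ , inc ∷ [] , _ , cover) , _) =
  single k , refl , cong (_∷ []) (increasing-ext inc (interval-increasing s (suc k)) (mk⇔ to from))
  where
  to : z ∈ B → z ∈ interval s (suc k)
  to z∈ = ∈-resp-↭ cover (∈-++⁺ˡ z∈)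
  from : z ∈ interval s (suc k) → z ∈ B
  from {z} z∈ = subst (z ∈_) (++-identityʳ B) (∈-resp-↭ (↭-sym cover) z∈)
complete s k ([] ∷ _ ∷ _)          ((() ∷ _ , _) , _)
complete s k ((_ ∷ _) ∷ [] ∷ _)    ((_ ∷ () ∷ _ , _) , _)
complete s k ((b ∷ bs) ∷ Q@((c ∷ cs) ∷ R)) ncmf = wrapping-shape ncmf (λ j → complete c j Q)

-- Enumerating shapes

growInitial : Shape → Shape
growInitial (single c)   = single (suc c)
growInitial (wrap c σ d) = wrap (suc c) σ d

growFinal : Shape × ℕ → Shape × ℕ
growFinal (σ , d) = σ , suc d

wrap₁ : Shape × ℕ → Shape
wrap₁ (σ , d) = wrap 0 σ d

-- A shape of size m + 2 either has an initial run of length at least two, or it is wrap₁ (σ , d)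
-- with size σ + (d + 1) = m + 1; such pairs are enumerated likewise by the length of the final run.
shapes       : ℕ → List Shape
tailedShapes : ℕ → List (Shape × ℕ)
shapes zero          = single 0 ∷ []
shapes (suc m)       = map growInitial (shapes m) ++ map wrap₁ (tailedShapes m)
tailedShapes zero    = []
tailedShapes (suc m) = map growFinal (tailedShapes m) ++ map (_, 0) (shapes m)

∈-shapes⁻       : ∀ m {σ} → σ ∈ shapes m → size σ ≡ suc m
∈-tailedShapes⁻ : ∀ m {σ d} → (σ , d) ∈ tailedShapes m → size σ + suc d ≡ suc m
∈-shapes⁻ zero (here refl) = refl
∈-shapes⁻ (suc m) σ∈ with ∈-++⁻ (map growInitial (shapes m)) σ∈
... | inj₁ σ∈grown with ∈-map⁻ growInitial σ∈grown
...   | single _   , σ∈′ , refl = cong suc (∈-shapes⁻ m σ∈′)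
...   | wrap _ _ _ , σ∈′ , refl = cong suc (∈-shapes⁻ m σ∈′)
∈-shapes⁻ (suc m) σ∈ | inj₂ σ∈wrapped with ∈-map⁻ wrap₁ σ∈wrapped
...   | _ , στ∈ , refl = cong suc (∈-tailedShapes⁻ m στ∈)
∈-tailedShapes⁻ (suc m) {σ} στ∈ with ∈-++⁻ (map growFinal (tailedShapes m)) στ∈
... | inj₁ στ∈grown with ∈-map⁻ growFinal στ∈grown
...   | (_ , d) , στ∈′ , refl = trans (+-suc (size σ) (suc d)) (cong suc (∈-tailedShapes⁻ m στ∈′))
∈-tailedShapes⁻ (suc m) {σ} στ∈ | inj₂ στ∈new with ∈-map⁻ (_, 0) στ∈new
...   | _ , σ∈ , refl = trans (+-comm (size σ) 1) (cong suc (∈-shapes⁻ m σ∈))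

∈-shapes⁺       : ∀ m σ → size σ ≡ suc m → σ ∈ shapes m
∈-tailedShapes⁺ : ∀ m σ d → size σ + suc d ≡ suc m → (σ , d) ∈ tailedShapes m
∈-shapes⁺ zero    (single zero)      _     = here refl
∈-shapes⁺ zero    (wrap c σ d)       size≡ =
  ⊥-elim (1+n≢0 (trans (sym (+-suc (size σ) d)) (m+n≡0⇒n≡0 c (suc-injective size≡))))
∈-shapes⁺ (suc m) (single (suc c))   size≡ =
  ∈-++⁺ˡ (∈-map⁺ growInitial (∈-shapes⁺ m (single c) (suc-injective size≡)))
∈-shapes⁺ (suc m) (wrap (suc c) σ d) size≡ =
  ∈-++⁺ˡ (∈-map⁺ growInitial (∈-shapes⁺ m (wrap c σ d) (suc-injective size≡)))
∈-shapes⁺ (suc m) (wrap zero σ d)    size≡ =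
  ∈-++⁺ʳ (map growInitial (shapes m)) (∈-map⁺ wrap₁ (∈-tailedShapes⁺ m σ d (suc-injective size≡)))
∈-tailedShapes⁺ zero    σ d       size≡ =
  ⊥-elim (<⇒≱ (+-monoˡ-< (suc d) (0<size σ)) (≤-trans (≤-reflexive size≡) (s≤s z≤n)))
∈-tailedShapes⁺ (suc m) σ zero    size≡ =
  ∈-++⁺ʳ (map growFinal (tailedShapes m))
         (∈-map⁺ (_, 0) (∈-shapes⁺ m σ (suc-injective (trans (+-comm 1 (size σ)) size≡))))
∈-tailedShapes⁺ (suc m) σ (suc d) size≡ =
  ∈-++⁺ˡ (∈-map⁺ growFinal
           (∈-tailedShapes⁺ m σ d (suc-injective (trans (sym (+-suc (size σ) (suc d))) size≡))))

growInitial-injective : ∀ {σ τ} → growInitial σ ≡ growInitial τ → σ ≡ τ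
growInitial-injective {single _}   {single _}   refl = refl
growInitial-injective {wrap _ _ _} {wrap _ _ _} refl = refl

shapes-unique       : ∀ m → Unique (shapes m)
tailedShapes-unique : ∀ m → Unique (tailedShapes m)
shapes-unique zero    = [] ∷ []
shapes-unique (suc m) =
  Unique.++⁺ (Unique.map⁺ growInitial-injective (shapes-unique m))
             (Unique.map⁺ (λ { refl → refl }) (tailedShapes-unique m)) disjoint
  where
  disjoint : ∀ {σ} → ¬ (σ ∈ map growInitial (shapes m) × σ ∈ map wrap₁ (tailedShapes m))
  disjoint (σ∈grown , σ∈wrapped) with ∈-map⁻ growInitial σ∈grown | ∈-map⁻ wrap₁ σ∈wrapped
  ... | single _   , _ , refl | _ , _ , ()
  ... | wrap _ _ _ , _ , refl | _ , _ , ()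
tailedShapes-unique zero    = []
tailedShapes-unique (suc m) =
  Unique.++⁺ (Unique.map⁺ (λ { refl → refl }) (tailedShapes-unique m))
             (Unique.map⁺ (λ { refl → refl }) (shapes-unique m)) disjoint
  where
  disjoint : ∀ {στ} → ¬ (στ ∈ map growFinal (tailedShapes m) × στ ∈ map (_, 0) (shapes m))
  disjoint (στ∈grown , στ∈new) with ∈-map⁻ growFinal στ∈grown | ∈-map⁻ (_, 0) στ∈new
  ... | _ , _ , refl | _ , _ , ()

-- Binomial sums

sumUpTo : (ℕ → ℕ) → ℕ → ℕ
sumUpTo f N = sum (applyUpTo f N)

infix 5 sumUpTo
syntax sumUpTo (λ t → e) N = ∑[ t < N ] e

∑-cong : ∀ {f g} → (∀ t → f t ≡ g t) → ∀ N → sumUpTo f N ≡ sumUpTo g N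
∑-cong f≗g zero    = refl
∑-cong f≗g (suc N) = cong₂ _+_ (f≗g 0) (∑-cong (f≗g ∘ suc) N)

∑-+ : ∀ f g N → ∑[ t < N ] (f t + g t) ≡ sumUpTo f N + sumUpTo g N
∑-+ f g zero    = refl
∑-+ f g (suc N) = trans (cong (f 0 + g 0 +_) (∑-+ (f ∘ suc) (g ∘ suc) N))
                        (interchange (f 0) (g 0) (sumUpTo (f ∘ suc) N) (sumUpTo (g ∘ suc) N))
  where open import Algebra.Properties.CommutativeSemigroup +-commutativeSemigroup using (interchange)

∑-*ˡ : ∀ q f N → ∑[ t < N ] (q * f t) ≡ q * sumUpTo f N
∑-*ˡ q f N = trans (cong sum (sym (map-applyUpTo f (q *_) N))) (sum-*ˡ q (applyUpTo f N))

∑-vanishing : ∀ f N n → (∀ t → N ≤ t → f t ≡ 0) → sumUpTo f (n + N) ≡ sumUpTo f N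
∑-vanishing f N zero    f≥N≡0 = refl
∑-vanishing f N (suc n) f≥N≡0 = begin
  sumUpTo f (suc n + N)
    ≡⟨ cong sum (sym (applyUpTo-∷ʳ f (n + N))) ⟩
  sum (applyUpTo f (n + N) ++ f (n + N) ∷ [])
    ≡⟨ sum-++ (applyUpTo f (n + N)) _ ⟩
  sumUpTo f (n + N) + (f (n + N) + 0)
    ≡⟨ cong (λ x → sumUpTo f (n + N) + (x + 0)) (f≥N≡0 (n + N) (m≤n+m N n)) ⟩
  sumUpTo f (n + N) + 0
    ≡⟨ +-identityʳ _ ⟩
  sumUpTo f (n + N)
    ≡⟨ ∑-vanishing f N n f≥N≡0 ⟩
  sumUpTo f N ∎
  where open ≡-Reasoning

evenSum oddSum : ℕ → ℕ → ℕ → ℕ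
evenSum q m N = ∑[ t < N ] (m C (2 * t)) * q ^ suc t
oddSum  q m N = ∑[ t < N ] (m C suc (2 * t)) * q ^ suc t

evenSum-suc : ∀ q m N → evenSum q (suc m) (suc N) ≡ evenSum q m (suc N) + q * oddSum q m N
evenSum-suc q m N = begin
  even 0 + (∑[ t < N ] (suc m C (2 * suc t)) * q ^ suc (suc t))
    ≡⟨ cong (even 0 +_) (∑-cong pascal N) ⟩
  even 0 + (∑[ t < N ] q * odd t + even (suc t))
    ≡⟨ cong (even 0 +_) (trans (∑-+ (λ t → q * odd t) (even ∘ suc) N)
                               (+-comm _ (sumUpTo (even ∘ suc) N))) ⟩
  even 0 + (sumUpTo (even ∘ suc) N + (∑[ t < N ] q * odd t))
    ≡⟨ sym (+-assoc (even 0) _ _) ⟩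
  evenSum q m (suc N) + (∑[ t < N ] q * odd t)
    ≡⟨ cong (evenSum q m (suc N) +_) (∑-*ˡ q odd N) ⟩
  evenSum q m (suc N) + q * oddSum q m N ∎
  where
  open ≡-Reasoning
  even odd : ℕ → ℕ
  even t = (m C (2 * t)) * q ^ suc t
  odd  t = (m C suc (2 * t)) * q ^ suc t
  pascal : ∀ t → (suc m C (2 * suc t)) * q ^ suc (suc t) ≡ q * odd t + even (suc t)
  pascal t = begin
    (suc m C (2 * suc t)) * q ^ suc (suc t)
      ≡⟨ cong (λ k → (suc m C k) * q ^ suc (suc t)) (*-suc 2 t) ⟩
    (suc m C suc (suc (2 * t))) * q ^ suc (suc t)
      ≡⟨ cong (_* q ^ suc (suc t)) (sym (nCk+nC[k+1]≡[n+1]C[k+1] m (suc (2 * t)))) ⟩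
    (m C suc (2 * t) + m C suc (suc (2 * t))) * q ^ suc (suc t)
      ≡⟨ *-distribʳ-+ (q ^ suc (suc t)) (m C suc (2 * t)) _ ⟩
    (m C suc (2 * t)) * (q * q ^ suc t) + (m C suc (suc (2 * t))) * q ^ suc (suc t)
      ≡⟨ cong₂ _+_ (x∙yz≈y∙xz (m C suc (2 * t)) q (q ^ suc t))
                   (cong (λ k → (m C k) * q ^ suc (suc t)) (sym (*-suc 2 t))) ⟩
    q * odd t + even (suc t) ∎
    where open import Algebra.Properties.CommutativeSemigroup *-commutativeSemigroup using (x∙yz≈y∙xz)

oddSum-suc : ∀ q m N → oddSum q (suc m) N ≡ evenSum q m N + oddSum q m N
oddSum-suc q m N = trans (∑-cong pascal N) (∑-+ even odd N)
  where
  even odd : ℕ → ℕ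
  even t = (m C (2 * t)) * q ^ suc t
  odd  t = (m C suc (2 * t)) * q ^ suc t
  pascal : ∀ t → (suc m C suc (2 * t)) * q ^ suc t ≡ even t + odd t
  pascal t = trans (cong (_* q ^ suc t) (sym (nCk+nC[k+1]≡[n+1]C[k+1] m (2 * t))))
                   (*-distribʳ-+ (q ^ suc t) (m C (2 * t)) _)

evenSum-vanishing : ∀ q m N n → m < 2 * N → evenSum q m (n + N) ≡ evenSum q m N
evenSum-vanishing q m N n m<2N = ∑-vanishing _ N n
  (λ t N≤t → cong (_* q ^ suc t) (k>n⇒nCk≡0 (<-≤-trans m<2N (*-monoʳ-≤ 2 N≤t))))

oddSum-vanishing : ∀ q m N n → m < 2 * N → oddSum q m (n + N) ≡ oddSum q m N
oddSum-vanishing q m N n m<2N = ∑-vanishing _ N n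
  (λ t N≤t → cong (_* q ^ suc t) (k>n⇒nCk≡0 (m<n⇒m<1+n (<-≤-trans m<2N (*-monoʳ-≤ 2 N≤t)))))

m<2*[1+m] : ∀ m → m < 2 * suc m
m<2*[1+m] m = m≤m+n (suc m) (suc m + 0)

m<2*[[m+2]/2] : ∀ m → m < 2 * ((suc m + 1) / 2)
m<2*[[m+2]/2] m = begin-strict
  m                       <⟨ n<1+n m ⟩
  suc m                   ≤⟨ ≤-pred (begin
  suc (suc m)             ≡⟨ cong suc (+-comm 1 m) ⟩
  suc m + 1               ≡⟨ m≡m%n+[m/n]*n (suc m + 1) 2 ⟩
  (suc m + 1) % 2 + K * 2 ≤⟨ +-monoˡ-≤ (K * 2) (≤-pred (m%n<n (suc m + 1) 2)) ⟩
  suc (K * 2)             ∎) ⟩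
  K * 2                   ≡⟨ *-comm K 2 ⟩
  2 * K                   ∎
  where
  open ≤-Reasoning
  K = (suc m + 1) / 2

rhs≡evenSum : ∀ m q → rhs (suc m) q ≡ evenSum q m (suc m)
rhs≡evenSum m q = begin
  rhs (suc m) q                         ≡⟨ cong (sum ∘ map term) (map-applyUpTo (λ t → t) suc K) ⟩
  sum (map term (applyUpTo suc K))      ≡⟨ cong sum (map-applyUpTo suc term K) ⟩
  evenSum q m K                         ≡⟨ sym (evenSum-vanishing q m K (suc m) (m<2*[[m+2]/2] m)) ⟩
  evenSum q m (suc m + K)               ≡⟨ cong (evenSum q m) (+-comm (suc m) K) ⟩
  evenSum q m (K + suc m)               ≡⟨ evenSum-vanishing q m (suc m) K (m<2*[1+m] m) ⟩
  evenSum q m (suc m)                   ∎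
  where
  open ≡-Reasoning
  K = (suc m + 1) / 2
  term : ℕ → ℕ
  term t = (m C (2 * (t ∸ 1))) * q ^ t

-- Counting

weight : ℕ → Shape → ℕ
weight q σ = q ^ depth σ

shapeSum tailedSum : ℕ → ℕ → ℕ
shapeSum  q m = sum (map (weight q) (shapes m))
tailedSum q m = sum (map (weight q ∘ proj₁) (tailedShapes m))

shapeSum-suc : ∀ q m → shapeSum q (suc m) ≡ shapeSum q m + q * tailedSum q m
shapeSum-suc q m = begin
  shapeSum q (suc m)
    ≡⟨ sum-map-++ (weight q) (map growInitial (shapes m)) (map wrap₁ (tailedShapes m)) ⟩
  sum (map (weight q) (map growInitial (shapes m)))
    + sum (map (weight q) (map wrap₁ (tailedShapes m)))
    ≡⟨ cong₂ _+_ (sum-map-∘ (weight q) growInitial (shapes m))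
                 (sum-map-∘ (weight q) wrap₁ (tailedShapes m)) ⟩
  sum (map (weight q ∘ growInitial) (shapes m))
    + sum (map ((q *_) ∘ (weight q ∘ proj₁)) (tailedShapes m))
    ≡⟨ cong₂ _+_ (cong sum (map-cong weight-growInitial (shapes m)))
                 (sym (sum-map-∘ (q *_) (weight q ∘ proj₁) (tailedShapes m))) ⟩
  shapeSum q m + sum (map (q *_) (map (weight q ∘ proj₁) (tailedShapes m)))
    ≡⟨ cong (shapeSum q m +_) (sum-*ˡ q (map (weight q ∘ proj₁) (tailedShapes m))) ⟩
  shapeSum q m + q * tailedSum q m ∎
  where
  open ≡-Reasoning
  weight-growInitial : ∀ σ → weight q (growInitial σ) ≡ weight q σ
  weight-growInitial (single _)   = refl
  weight-growInitial (wrap _ _ _) = refl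

tailedSum-suc : ∀ q m → tailedSum q (suc m) ≡ tailedSum q m + shapeSum q m
tailedSum-suc q m = begin
  tailedSum q (suc m)
    ≡⟨ sum-map-++ (weight q ∘ proj₁) (map growFinal (tailedShapes m)) (map (_, 0) (shapes m)) ⟩
  sum (map (weight q ∘ proj₁) (map growFinal (tailedShapes m)))
    + sum (map (weight q ∘ proj₁) (map (_, 0) (shapes m)))
    ≡⟨ cong₂ _+_ (sum-map-∘ (weight q ∘ proj₁) growFinal (tailedShapes m))
                 (sum-map-∘ (weight q ∘ proj₁) (_, 0) (shapes m)) ⟩
  tailedSum q m + shapeSum q m ∎
  where open ≡-Reasoning

shapeSum≡evenSum : ∀ q m → shapeSum q m ≡ evenSum q m (suc m) × tailedSum q m ≡ oddSum q m (suc m)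
shapeSum≡evenSum q zero    = sym (cong (_+ 0) (*-identityˡ (q ^ 1))) , refl
shapeSum≡evenSum q (suc m) with shapeSum≡evenSum q m
... | shape≡even , tailed≡odd = shapes-step , tailed-step
  where
  open ≡-Reasoning
  even-stable : evenSum q m (suc (suc m)) ≡ evenSum q m (suc m)
  even-stable = evenSum-vanishing q m (suc m) 1 (m<2*[1+m] m)
  odd-stable : oddSum q m (suc (suc m)) ≡ oddSum q m (suc m)
  odd-stable = oddSum-vanishing q m (suc m) 1 (m<2*[1+m] m)

  shapes-step : shapeSum q (suc m) ≡ evenSum q (suc m) (suc (suc m))
  shapes-step = begin
    shapeSum q (suc m)                                  ≡⟨ shapeSum-suc q m ⟩
    shapeSum q m + q * tailedSum q m                    ≡⟨ cong₂ (λ a b → a + q * b) shape≡even tailed≡odd ⟩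
    evenSum q m (suc m) + q * oddSum q m (suc m)        ≡⟨ cong (_+ q * oddSum q m (suc m)) (sym even-stable) ⟩
    evenSum q m (suc (suc m)) + q * oddSum q m (suc m)  ≡⟨ sym (evenSum-suc q m (suc m)) ⟩
    evenSum q (suc m) (suc (suc m))                     ∎

  tailed-step : tailedSum q (suc m) ≡ oddSum q (suc m) (suc (suc m))
  tailed-step = begin
    tailedSum q (suc m)                                 ≡⟨ tailedSum-suc q m ⟩
    tailedSum q m + shapeSum q m                        ≡⟨ cong₂ _+_ tailed≡odd shape≡even ⟩
    oddSum q m (suc m) + evenSum q m (suc m)            ≡⟨ +-comm (oddSum q m (suc m)) _ ⟩
    evenSum q m (suc m) + oddSum q m (suc m)            ≡⟨ sym (cong₂ _+_ even-stable odd-stable) ⟩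
    evenSum q m (2 + m) + oddSum q m (2 + m)            ≡⟨ sym (oddSum-suc q m (suc (suc m))) ⟩
    oddSum q (suc m) (suc (suc m))                      ∎

∈-partitions⇔ncmf : ∀ m {P} → P ∈ map (partition 1) (shapes m) ⇔ NCMF (suc m) P
∈-partitions⇔ncmf m {P} = mk⇔ to from
  where
  [m+1]≡interval = [n]≡interval (suc m)
  to : P ∈ map (partition 1) (shapes m) → NCMF (suc m) P
  to P∈ with ∈-map⁻ (partition 1) P∈
  ... | σ , σ∈ , refl =
    subst (λ X → NCMFOf X P) (trans (cong (interval 1) (∈-shapes⁻ m σ∈)) (sym [m+1]≡interval))
          (partition-ncmf 1 σ)
  from : NCMF (suc m) P → P ∈ map (partition 1) (shapes m)
  from ncmf with complete 1 m P (subst (λ X → NCMFOf X P) [m+1]≡interval ncmf)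
  ... | σ , size≡ , refl = ∈-map⁺ (partition 1) (∈-shapes⁺ m σ size≡)

theorem37 : (n : ℕ) → 1 ≤ n → (Mₙ : List Partition) → Unique Mₙ →
            (∀ P → (P ∈ Mₙ) ⇔ NCMF n P) →
            (q : ℕ) → sum (map (λ P → q ^ blocks P) Mₙ) ≡ rhs n q
theorem37 (suc m) _ Mₙ Mₙ! Mₙ⇔ncmf q = begin
  sum (map (λ P → q ^ blocks P) Mₙ)
    ≡⟨ sum-↭ (Perm.map⁺ (λ P → q ^ blocks P) Mₙ↭) ⟩
  sum (map (λ P → q ^ blocks P) (map (partition 1) (shapes m)))
    ≡⟨ sum-map-∘ (λ P → q ^ blocks P) (partition 1) (shapes m) ⟩
  sum (map (λ σ → q ^ blocks (partition 1 σ)) (shapes m))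
    ≡⟨ cong sum (map-cong (cong (q ^_) ∘ blocks-partition 1) (shapes m)) ⟩
  shapeSum q m
    ≡⟨ proj₁ (shapeSum≡evenSum q m) ⟩
  evenSum q m (suc m)
    ≡⟨ sym (rhs≡evenSum m q) ⟩
  rhs (suc m) q ∎
  where
  open ≡-Reasoning
  Mₙ↭ : Mₙ ↭ map (partition 1) (shapes m)
  Mₙ↭ = unique∧set⇒↭ Mₙ! (Unique.map⁺ (partition-injective 1) (shapes-unique m))
          (λ {P} → ⇔-trans (Mₙ⇔ncmf P) (⇔-sym (∈-partitions⇔ncmf m)))
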